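{- Let $m\ge 2$ and $s\in[1,m]$ be integers, and let $\pi:\mathbb{F}_2^m\to\mathbb{F}_2^m$ be $\pi(x_1,\dots,x_m)=(x_1+P(x_2,\dots,x_m),x_2,\dots,x_m)$, where $$P(X_2,\dots,X_m)=\sum_{\ell=0}^{m-1}\sum_{2\le i_1<\dots<i_\ell\le m}\alpha_{i_1\cdots i_\ell}X_{i_1}\cdots X_{i_\ell},\qquad \alpha_{i_1\cdots i_\ell}\in\mathbb{F}_2.$$ (A) If $L=\{(x_1,\dots,x_s,0,\dots,0):x_i\in\mathbb{F}_2\}$ (last $m-s$ coordinates zero), then $(\pi,L)$ satisfies the $\mathcal{C}$-condition. (B) If $L=\{(0,\dots,0,x_{s+1},\dots,x_m):x_i\in\mathbb{F}_2\}$ (first $s$ coordinates zero) and $\alpha_{i_1\cdots i_\ell}=0$ for all index tuples $(i_1,\dots,i_\ell)$ with $|\{j: i_j>s\}|\ge 2$, then $(\pi,L)$ satisfies the $\mathcal{C}$-condition. (C) If $L=\{(0,\dots,0,x_{s+1},\dots,x_m):x_i\in\mathbb{F}_2\}$ and $\alpha_{i_1\cdots i_\ell}=1$ for some index tuple $(i_1,\dots,i_\ell)$ with $|\{j:i_j>s\}|\ge 2$, then $(\pi,L)$ does not satisfy the $\mathcal{C}$-condition. Moreover, in cases (A) and (B), the function $f_{(\pi,L)}$ is a bent function (of the $\mathcal{C}$-class).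
   Context: $\mathbb{F}_2$ is the field with two elements; for $x,y\in\mathbb{F}_2^m$, $x\cdot y=\sum_i x_iy_i$. For an $\mathbb{F}_2$-subspace $L$ of $\mathbb{F}_2^m$, $L^\perp=\{y: x\cdot y=0\ \forall x\in L\}$ and $1_{L^\perp}$ is its indicator function. For a permutation $\pi$ of $\mathbb{F}_2^m$, $f_{(\pi,L)}:\mathbb{F}_2^m\times\mathbb{F}_2^m\to\mathbb{F}_2$ is $f_{(\pi,L)}(x,y)=x\cdot\pi(y)+1_{L^\perp}(x)$. The pair $(\pi,L)$ satisfies the $\mathcal{C}$-condition if for every $a\in\mathbb{F}_2^m$ the set $\pi^{ -1}(a+L)$ is a flat (affine subspace) of $\mathbb{F}_2^m$. A Boolean function $f$ on $\mathbb{F}_2^{2m}$ is bent if $|\sum_{z}(-1)^{f(z)+u\cdot z}|=2^m$ for all $u\in\mathbb{F}_2^{2m}$ (equivalently, for $2m>2$, its support is a difference set in $\mathbb{F}_2^{2m}$ with parameters $(2^{2m},2^{2m-1}\pm2^{m-1},2^{2m-2}\pm2^{m-1})$). -}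

module Defs where

open import Data.Bool using (Bool; true; false; _∧_; _∨_; not; _xor_; if_then_else_)
open import Data.Nat using (ℕ; zero; suc; _+_; _<ᵇ_)
open import Data.Fin using (Fin; toℕ)
open import Data.Vec using (Vec; []; _∷_; zipWith; lookup; tabulate; replicate)
import Data.Vec as V
open import Data.List using (List; []; _∷_; map; _++_; foldr; concatMap)
open import Data.Integer using (ℤ; +_; -[1+_])
import Data.Integer as ℤ
open import Data.Product using (Σ; _×_; _,_)
open import Relation.Binary.PropositionalEquality using (_≡_)

-- F₂ = Bool (false = 0, true = 1, xor = +, ∧ = ·); F₂^m = Vec Bool m.

_⊕_ : ∀ {m} → Vec Bool m → Vec Bool m → Vec Bool m
_⊕_ = zipWith _xor_

zeroVec : ∀ {m} → Vec Bool m
zeroVec = replicate _ false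

dot : ∀ {m} → Vec Bool m → Vec Bool m → Bool
dot x y = V.foldr _ _xor_ false (zipWith _∧_ x y)

allVecs : ∀ m → List (Vec Bool m)
allVecs zero = [] ∷ []
allVecs (suc m) = map (false ∷_) (allVecs m) ++ map (true ∷_) (allVecs m)

Subset : ℕ → Set
Subset m = Vec Bool m → Bool

IsSubspace : ∀ {m} → Subset m → Set
IsSubspace {m} V = (V zeroVec ≡ true)
  × (∀ (x y : Vec Bool m) → V x ≡ true → V y ≡ true → V (x ⊕ y) ≡ true)

-- flat (affine subspace): S = c + V for some point c and subspace V.
-- (x ∈ c + V  ⇔  x + c ∈ V, since we are in characteristic 2)
IsFlat : ∀ {m} → Subset m → Set
IsFlat {m} S = Σ (Vec Bool m) λ c → Σ (Subset m) λ V →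
  IsSubspace V × (∀ x → S x ≡ V (x ⊕ c))

coset : ∀ {m} → Vec Bool m → Subset m → Subset m
coset a L y = L (y ⊕ a)

preimage : ∀ {m} → (Vec Bool m → Vec Bool m) → Subset m → Subset m
preimage π S x = S (π x)

CCondition : ∀ {m} → (Vec Bool m → Vec Bool m) → Subset m → Set
CCondition {m} π L = ∀ (a : Vec Bool m) → IsFlat (preimage π (coset a L))

perpInd : ∀ {m} → Subset m → Vec Bool m → Bool
perpInd {m} L x = foldr (λ y b → (not (L y) ∨ not (dot x y)) ∧ b) true (allVecs m)

fC : ∀ {m} → (Vec Bool m → Vec Bool m) → Subset m → Vec Bool m → Vec Bool m → Bool
fC π L x y = dot x (π y) xor perpInd L x

sign : Bool → ℤ
sign false = + 1
sign true  = -[1+ 0 ]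

sumℤ : List ℤ → ℤ
sumℤ = foldr ℤ._+_ (+ 0)

walsh : ∀ {m} → (Vec Bool m → Vec Bool m → Bool) → Vec Bool m → Vec Bool m → ℤ
walsh {m} f u₁ u₂ =
  sumℤ (concatMap (λ x → map (λ y → sign (f x y xor (dot u₁ x xor dot u₂ y)))
                             (allVecs m))
                  (allVecs m))

IsBent : ∀ {m} → (Vec Bool m → Vec Bool m → Bool) → Set
IsBent {m} f = ∀ (u₁ u₂ : Vec Bool m) → ℤ.∣ walsh f u₁ u₂ ∣ ≡ 2 Data.Nat.^ m
  where import Data.Nat

-- Take m = suc n.  A monomial X_{i₁}⋯X_{i_ℓ} (2 ≤ i₁ < … < i_ℓ ≤ m) is
-- encoded by its index set S ⊆ {2,…,m}, given as a characteristic vector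
-- S : Vec Bool n, where coordinate j : Fin n stands for index i = toℕ j + 2.
-- The coefficients are α : Vec Bool n → Bool, α S = α_{i₁⋯i_ℓ}.

monomial : ∀ {n} → Vec Bool n → Vec Bool n → Bool
monomial S xs = V.foldr _ _∧_ true (zipWith (λ s x → not s ∨ x) S xs)

polyP : ∀ {n} → (Vec Bool n → Bool) → Vec Bool n → Bool
polyP {n} α xs = foldr _xor_ false (map (λ S → α S ∧ monomial S xs) (allVecs n))

piP : ∀ {n} → (Vec Bool n → Bool) → Vec Bool (suc n) → Vec Bool (suc n)
piP α (x ∷ xs) = (x xor polyP α xs) ∷ xs

highCount : ∀ {n} → ℕ → Vec Bool n → ℕ
highCount {n} s S =
  V.sum (tabulate {n = n} (λ j → if lookup S j ∧ (s <ᵇ (toℕ j + 2)) then 1 else 0))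

-- L_A = { (x₁,…,x_s,0,…,0) } : coordinate i (1-based i = toℕ i + 1) is 0 when i > s
LA : ∀ {m} → ℕ → Subset m
LA {m} s x = V.foldr _ _∧_ true
  (tabulate {n = m} (λ i → if s <ᵇ (toℕ i + 1) then not (lookup x i) else true))

LB : ∀ {m} → ℕ → Subset m
LB {m} s x = V.foldr _ _∧_ true
  (tabulate {n = m} (λ i → if s <ᵇ (toℕ i + 1) then true else not (lookup x i)))

-- Write H for the
-- coordinates i > s.  For L_A the first coordinate is free in L, so
-- π⁻¹(a + L) = a + L.  For L_B, π⁻¹(a + L) is the graph of x ↦ P(x) + a₁ over a
-- coset of the coordinate subspace spanned by H, and such a graph is a flat iff
-- P is affine on every coset of that subspace.  A monomial with at most one
-- variable in H is affine there, which gives (B); conversely, splitting the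
-- algebraic normal form one variable at a time turns a nonzero coefficient of a
-- monomial with two variables in H into x, y, z with x + y, x + z in the
-- subspace and P(x + y + z) ≠ P(x) + P(y) + P(z), which gives (C).
--
-- Bentness holds for every permutation π and coordinate subspace L with the
-- C-condition: the Walsh coefficient at (u₁, u₂) is
--   2ᵐ (-1)^(u₂·π⁻¹(u₁)) − 2 |L⊥| Σ_{y ∈ π⁻¹(u₁ + L)} (-1)^(u₂·y),
-- and the character sum over the flat π⁻¹(u₁ + L) = c + V is 0 or
-- (-1)^(u₂·c) |V| with |V| = |L|; in the second case π⁻¹(u₁) ∈ c + V, so both
-- terms have the same sign and the coefficient is ±(2ᵐ − 2 |L⊥| |L|) = ∓2ᵐ.

module Submission where

open import Defs
open import Algebra.Bundles using (CommutativeMonoid; CommutativeRing)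
open import Algebra.Structures using (IsCommutativeMonoid)
open import Data.Bool using (Bool; true; false; _∧_; _∨_; not; _xor_; if_then_else_)
open import Data.Bool.Properties
  using ( xor-assoc; xor-comm; xor-identityʳ; xor-same; xor-∧-commutativeRing; not-involutive
        ; ∨-zeroʳ; ∧-isCommutativeMonoid; ∧-comm; ∧-idem; ∧-zeroʳ; ∧-identityʳ
        ; ∧-distribˡ-xor; ∧-distribʳ-xor )
import Data.Bool as Bool
open import Algebra.Properties.CommutativeSemigroup (CommutativeRing.+-commutativeSemigroup xor-∧-commutativeRing)
  using () renaming (interchange to xor-interchange; x∙yz≈y∙xz to xor-swapˡ)
open import Data.Nat using (ℕ; zero; suc; _≤_; s≤s; z≤n; _<ᵇ_; _^_)
import Data.Nat as ℕ
import Data.Nat.Properties as ℕP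
open import Data.Fin using (Fin; toℕ; zero; suc)
open import Data.Integer using (ℤ; +_; +0; +[1+_]; -[1+_]; _+_; _*_; -_)
import Data.Integer as ℤ
import Data.Integer.Properties as ℤP
open import Data.Integer.Tactic.RingSolver using (solve-∀)
open import Data.List using (List; []; _∷_; map; _++_; foldr; concatMap)
import Data.List.Properties as List
open import Data.Vec using (Vec; []; _∷_; replicate; tabulate; lookup)
import Data.Vec as V
import Data.Vec.Properties as VP
open import Data.Product using (Σ; _×_; _,_; ∃)
open import Data.Sum using (_⊎_; inj₁; inj₂)
open import Data.Empty using (⊥; ⊥-elim)
open import Function using (_∘_; id; case_of_)
open import Level using (0ℓ)
open import Relation.Binary.PropositionalEquality
open import Relation.Nullary using (¬_; Dec; yes; no; does)
open import Relation.Nullary.Decidable using (dec-true)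

xor-cancelʳ : ∀ a b → (a xor b) xor b ≡ a
xor-cancelʳ a b = trans (xor-assoc a b b) (trans (cong (a xor_) (xor-same b)) (xor-identityʳ a))

xor-cancelˡ : ∀ a b → a xor (a xor b) ≡ b
xor-cancelˡ a b = trans (sym (xor-assoc a a b)) (cong (_xor b) (xor-same a))

xor-shift : ∀ a b c → (a xor c) xor (b xor c) ≡ a xor b
xor-shift a b c =
  trans (xor-interchange a c b c) (trans (cong ((a xor b) xor_) (xor-same c)) (xor-identityʳ (a xor b)))

xor-shift₃ : ∀ a b d c → ((a xor c) xor (b xor c)) xor (d xor c) ≡ ((a xor b) xor d) xor c
xor-shift₃ a b d c = trans (cong (_xor (d xor c)) (xor-shift a b c)) (sym (xor-assoc (a xor b) d c))

private
  ∧-true₁ : ∀ {a b} → a ∧ b ≡ true → a ≡ true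
  ∧-true₁ {true} _ = refl

  ∧-true₂ : ∀ {a b} → a ∧ b ≡ true → b ≡ true
  ∧-true₂ {true} ab = ab

  not-xor-true⇒≡ : ∀ a b → not (a xor b) ≡ true → a ≡ b
  not-xor-true⇒≡ false false _ = refl
  not-xor-true⇒≡ true  true  _ = refl

⊕-assoc : ∀ {m} (x y z : Vec Bool m) → (x ⊕ y) ⊕ z ≡ x ⊕ (y ⊕ z)
⊕-assoc []       []       []       = refl
⊕-assoc (a ∷ x) (b ∷ y) (c ∷ z) = cong₂ _∷_ (xor-assoc a b c) (⊕-assoc x y z)

⊕-comm : ∀ {m} (x y : Vec Bool m) → x ⊕ y ≡ y ⊕ x
⊕-comm []      []      = refl
⊕-comm (a ∷ x) (b ∷ y) = cong₂ _∷_ (xor-comm a b) (⊕-comm x y)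

⊕-identityˡ : ∀ {m} (x : Vec Bool m) → zeroVec ⊕ x ≡ x
⊕-identityˡ []      = refl
⊕-identityˡ (a ∷ x) = cong (a ∷_) (⊕-identityˡ x)

⊕-self : ∀ {m} (x : Vec Bool m) → x ⊕ x ≡ zeroVec
⊕-self []      = refl
⊕-self (a ∷ x) = cong₂ _∷_ (xor-same a) (⊕-self x)

⊕-cancelʳ : ∀ {m} (x c : Vec Bool m) → (x ⊕ c) ⊕ c ≡ x
⊕-cancelʳ []      []      = refl
⊕-cancelʳ (a ∷ x) (b ∷ c) = cong₂ _∷_ (xor-cancelʳ a b) (⊕-cancelʳ x c)

⊕-shift : ∀ {m} (x y c : Vec Bool m) → (x ⊕ c) ⊕ (y ⊕ c) ≡ x ⊕ y
⊕-shift []      []      []      = refl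
⊕-shift (a ∷ x) (b ∷ y) (c ∷ z) = cong₂ _∷_ (xor-shift a b c) (⊕-shift x y z)

⊕-shift₃ : ∀ {m} (x y z c : Vec Bool m) → ((x ⊕ c) ⊕ (y ⊕ c)) ⊕ (z ⊕ c) ≡ ((x ⊕ y) ⊕ z) ⊕ c
⊕-shift₃ x y z c = trans (cong (_⊕ (z ⊕ c)) (⊕-shift x y c)) (sym (⊕-assoc (x ⊕ y) z c))

⊕≡zero⇒≡ : ∀ {m} (x u : Vec Bool m) → x ⊕ u ≡ zeroVec → x ≡ u
⊕≡zero⇒≡ x u x⊕u≡0 = trans (sym (⊕-cancelʳ x u)) (trans (cong (_⊕ u) x⊕u≡0) (⊕-identityˡ u))

dot-comm : ∀ {m} (x y : Vec Bool m) → dot x y ≡ dot y x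
dot-comm []      []      = refl
dot-comm (a ∷ x) (b ∷ y) = cong₂ _xor_ (∧-comm a b) (dot-comm x y)

dot-⊕ʳ : ∀ {m} (x y z : Vec Bool m) → dot x (y ⊕ z) ≡ dot x y xor dot x z
dot-⊕ʳ []      []      []      = refl
dot-⊕ʳ (a ∷ x) (b ∷ y) (c ∷ z) = begin
  (a ∧ (b xor c)) xor dot x (y ⊕ z)             ≡⟨ cong₂ _xor_ (∧-distribˡ-xor a b c) (dot-⊕ʳ x y z) ⟩
  ((a ∧ b) xor (a ∧ c)) xor (dot x y xor dot x z) ≡⟨ xor-interchange (a ∧ b) (a ∧ c) (dot x y) (dot x z) ⟩
  ((a ∧ b) xor dot x y) xor ((a ∧ c) xor dot x z) ∎
  where open ≡-Reasoning

dot-zeroʳ : ∀ {m} (x : Vec Bool m) → dot x zeroVec ≡ false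
dot-zeroʳ []      = refl
dot-zeroʳ (a ∷ x) = trans (cong (_xor dot x zeroVec) (∧-zeroʳ a)) (dot-zeroʳ x)

-- Big operators over F₂^m

module BigOperator {A : Set} {_∙_ : A → A → A} {ε : A}
                   (isCommutativeMonoid : IsCommutativeMonoid _≡_ _∙_ ε) where

  open IsCommutativeMonoid isCommutativeMonoid using (identityˡ; identityʳ; assoc; comm)

  private
    commutativeMonoid : CommutativeMonoid 0ℓ 0ℓ
    commutativeMonoid = record { isCommutativeMonoid = isCommutativeMonoid }

  open import Algebra.Properties.CommutativeSemigroup (CommutativeMonoid.commutativeSemigroup commutativeMonoid)
    using (interchange)

  ⨁ : ∀ {m} → (Vec Bool m → A) → A
  ⨁ g = foldr _∙_ ε (map g (allVecs _))

  foldr-++ : (xs ys : List A) → foldr _∙_ ε (xs ++ ys) ≡ foldr _∙_ ε xs ∙ foldr _∙_ ε ys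
  foldr-++ []       ys = sym (identityˡ _)
  foldr-++ (x ∷ xs) ys = trans (cong (x ∙_) (foldr-++ xs ys)) (sym (assoc x _ _))

  foldr-concatMap : ∀ {B C : Set} (f : B → C → A) (xs : List B) (ys : List C)
    → foldr _∙_ ε (concatMap (λ x → map (f x) ys) xs)
      ≡ foldr _∙_ ε (map (λ x → foldr _∙_ ε (map (f x) ys)) xs)
  foldr-concatMap f []       ys = refl
  foldr-concatMap f (x ∷ xs) ys =
    trans (foldr-++ (map (f x) ys) _) (cong (_ ∙_) (foldr-concatMap f xs ys))

  ⨁-cons : ∀ {m} (g : Vec Bool (suc m) → A)
    → ⨁ g ≡ ⨁ (λ x → g (false ∷ x)) ∙ ⨁ (λ x → g (true ∷ x))
  ⨁-cons {m} g = begin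
    foldr _∙_ ε (map g (map (false ∷_) xs ++ map (true ∷_) xs))
      ≡⟨ cong (foldr _∙_ ε) (List.map-++ g (map (false ∷_) xs) _) ⟩
    foldr _∙_ ε (map g (map (false ∷_) xs) ++ map g (map (true ∷_) xs))
      ≡⟨ foldr-++ (map g (map (false ∷_) xs)) _ ⟩
    foldr _∙_ ε (map g (map (false ∷_) xs)) ∙ foldr _∙_ ε (map g (map (true ∷_) xs))
      ≡⟨ sym (cong₂ (λ u v → foldr _∙_ ε u ∙ foldr _∙_ ε v) (List.map-∘ xs) (List.map-∘ xs)) ⟩
    ⨁ (λ x → g (false ∷ x)) ∙ ⨁ (λ x → g (true ∷ x)) ∎
    where open ≡-Reasoning
          xs = allVecs m

  ⨁-cong : ∀ {m} {g h : Vec Bool m → A} → (∀ x → g x ≡ h x) → ⨁ g ≡ ⨁ h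
  ⨁-cong {m} g≗h = cong (foldr _∙_ ε) (List.map-cong g≗h (allVecs m))

  ⨁-const-ε : ∀ m → ⨁ {m} (λ _ → ε) ≡ ε
  ⨁-const-ε zero    = identityʳ ε
  ⨁-const-ε (suc m) =
    trans (⨁-cons {m} (λ _ → ε)) (trans (cong₂ _∙_ (⨁-const-ε m) (⨁-const-ε m)) (identityʳ ε))

  ⨁-∙ : ∀ m (g h : Vec Bool m → A) → ⨁ (λ x → g x ∙ h x) ≡ ⨁ g ∙ ⨁ h
  ⨁-∙ zero    g h = begin
    (g [] ∙ h []) ∙ ε        ≡⟨ identityʳ (g [] ∙ h []) ⟩
    g [] ∙ h []              ≡⟨ sym (cong₂ _∙_ (identityʳ (g [])) (identityʳ (h []))) ⟩
    (g [] ∙ ε) ∙ (h [] ∙ ε)  ∎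
    where open ≡-Reasoning
  ⨁-∙ (suc m) g h = begin
    ⨁ (λ x → g x ∙ h x)
      ≡⟨ ⨁-cons (λ x → g x ∙ h x) ⟩
    ⨁ (λ x → g (false ∷ x) ∙ h (false ∷ x)) ∙ ⨁ (λ x → g (true ∷ x) ∙ h (true ∷ x))
      ≡⟨ cong₂ _∙_ (⨁-∙ m (λ x → g (false ∷ x)) (λ x → h (false ∷ x)))
                   (⨁-∙ m (λ x → g (true ∷ x)) (λ x → h (true ∷ x))) ⟩
    (⨁ (λ x → g (false ∷ x)) ∙ ⨁ (λ x → h (false ∷ x)))
      ∙ (⨁ (λ x → g (true ∷ x)) ∙ ⨁ (λ x → h (true ∷ x)))
      ≡⟨ interchange _ _ _ _ ⟩
    (⨁ (λ x → g (false ∷ x)) ∙ ⨁ (λ x → g (true ∷ x)))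
      ∙ (⨁ (λ x → h (false ∷ x)) ∙ ⨁ (λ x → h (true ∷ x)))
      ≡⟨ sym (cong₂ _∙_ (⨁-cons g) (⨁-cons h)) ⟩
    ⨁ g ∙ ⨁ h ∎
    where open ≡-Reasoning

  ⨁-translate : ∀ m (g : Vec Bool m → A) (t : Vec Bool m) → ⨁ (λ x → g (x ⊕ t)) ≡ ⨁ g
  ⨁-translate zero    g [] = refl
  ⨁-translate (suc m) g (b ∷ t) = begin
    ⨁ (λ x → g (x ⊕ (b ∷ t)))
      ≡⟨ ⨁-cons (λ x → g (x ⊕ (b ∷ t))) ⟩
    ⨁ (λ x → g ((false xor b) ∷ (x ⊕ t))) ∙ ⨁ (λ x → g ((true xor b) ∷ (x ⊕ t)))
      ≡⟨ cong₂ _∙_ (⨁-translate m (λ x → g ((false xor b) ∷ x)) t)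
                   (⨁-translate m (λ x → g ((true xor b) ∷ x)) t) ⟩
    ⨁ (λ x → g ((false xor b) ∷ x)) ∙ ⨁ (λ x → g ((true xor b) ∷ x))
      ≡⟨ halves b ⟩
    ⨁ (λ x → g (false ∷ x)) ∙ ⨁ (λ x → g (true ∷ x))
      ≡⟨ sym (⨁-cons g) ⟩
    ⨁ g ∎
    where
    open ≡-Reasoning
    halves : ∀ b → ⨁ (λ x → g ((false xor b) ∷ x)) ∙ ⨁ (λ x → g ((true xor b) ∷ x))
                 ≡ ⨁ (λ x → g (false ∷ x)) ∙ ⨁ (λ x → g (true ∷ x))
    halves false = refl
    halves true  = comm _ _

  ⨁-swap : ∀ {m k} (f : Vec Bool m → Vec Bool k → A)
    → ⨁ (λ x → ⨁ (λ y → f x y)) ≡ ⨁ (λ y → ⨁ (λ x → f x y))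
  ⨁-swap {zero}  f = trans (identityʳ (⨁ (f []))) (⨁-cong (λ y → sym (identityʳ (f [] y))))
  ⨁-swap {suc m} {k} f = begin
    ⨁ (λ x → ⨁ (λ y → f x y))
      ≡⟨ ⨁-cons (λ x → ⨁ (f x)) ⟩
    ⨁ (λ x → ⨁ (λ y → f (false ∷ x) y)) ∙ ⨁ (λ x → ⨁ (λ y → f (true ∷ x) y))
      ≡⟨ cong₂ _∙_ (⨁-swap (λ x → f (false ∷ x))) (⨁-swap (λ x → f (true ∷ x))) ⟩
    ⨁ (λ y → ⨁ (λ x → f (false ∷ x) y)) ∙ ⨁ (λ y → ⨁ (λ x → f (true ∷ x) y))
      ≡⟨ sym (⨁-∙ k (λ y → ⨁ (λ x → f (false ∷ x) y)) (λ y → ⨁ (λ x → f (true ∷ x) y))) ⟩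
    ⨁ (λ y → ⨁ (λ x → f (false ∷ x) y) ∙ ⨁ (λ x → f (true ∷ x) y))
      ≡⟨ ⨁-cong (λ y → sym (⨁-cons (λ x → f x y))) ⟩
    ⨁ (λ y → ⨁ (λ x → f x y)) ∎
    where open ≡-Reasoning

module XorSum = BigOperator (CommutativeRing.+-isCommutativeMonoid xor-∧-commutativeRing)
module Conjunction = BigOperator ∧-isCommutativeMonoid

-- Flats and coordinate subspaces

AffinelyClosed : ∀ {m} → Subset m → Set
AffinelyClosed {m} S = ∀ (x y z : Vec Bool m)
  → S x ≡ true → S y ≡ true → S z ≡ true → S ((x ⊕ y) ⊕ z) ≡ true

isFlat⇒affinelyClosed : ∀ {m} {S : Subset m} → IsFlat S → AffinelyClosed S
isFlat⇒affinelyClosed (c , V , (_ , V-⊕) , S≗V) x y z Sx Sy Sz =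
  trans (S≗V ((x ⊕ y) ⊕ z)) (subst (λ v → V v ≡ true) (⊕-shift₃ x y z c)
    (V-⊕ _ _ (V-⊕ _ _ (inV x Sx) (inV y Sy)) (inV z Sz)))
  where
  inV : ∀ v → _ ≡ true → V (v ⊕ c) ≡ true
  inV v Sv = trans (sym (S≗V v)) Sv

affinelyClosed⇒isFlat : ∀ {m} {S : Subset m} (c : Vec Bool m)
  → S c ≡ true → AffinelyClosed S → IsFlat S
affinelyClosed⇒isFlat {S = S} c Sc closed =
  c , (λ v → S (v ⊕ c)) , (S-zero , S-⊕) , λ x → cong S (sym (⊕-cancelʳ x c))
  where
  S-zero : S (zeroVec ⊕ c) ≡ true
  S-zero = subst (λ v → S v ≡ true) (sym (⊕-identityˡ c)) Sc
  S-⊕ : ∀ x y → S (x ⊕ c) ≡ true → S (y ⊕ c) ≡ true → S ((x ⊕ y) ⊕ c) ≡ true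
  S-⊕ x y Sx Sy = subst (λ v → S (v ⊕ c) ≡ true) (⊕-shift x y c) (closed _ _ _ Sx Sy Sc)

isFlat-cong : ∀ {m} {S T : Subset m} → (∀ x → S x ≡ T x) → IsFlat S → IsFlat T
isFlat-cong S≗T (c , V , V-subspace , S≗V) = c , V , V-subspace , λ x → trans (sym (S≗T x)) (S≗V x)

coordSub : ∀ {m} → Vec Bool m → Subset m
coordSub []      []      = true
coordSub (μ ∷ M) (b ∷ x) = (μ ∨ not b) ∧ coordSub M x

complement : ∀ {m} → Vec Bool m → Vec Bool m
complement = V.map not

complement-involutive : ∀ {m} (M : Vec Bool m) → complement (complement M) ≡ M
complement-involutive M =
  trans (sym (VP.map-∘ not not M)) (trans (VP.map-cong not-involutive M) (VP.map-id M))

coordSub-zero : ∀ {m} (M : Vec Bool m) → coordSub M zeroVec ≡ true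
coordSub-zero []          = refl
coordSub-zero (true ∷ M)  = coordSub-zero M
coordSub-zero (false ∷ M) = coordSub-zero M

coordSub-⊕ : ∀ {m} (M x y : Vec Bool m)
  → coordSub M x ≡ true → coordSub M y ≡ true → coordSub M (x ⊕ y) ≡ true
coordSub-⊕ []          []          []          _  _  = refl
coordSub-⊕ (true ∷ M)  (a ∷ x)     (b ∷ y)     Mx My = coordSub-⊕ M x y Mx My
coordSub-⊕ (false ∷ M) (false ∷ x) (false ∷ y) Mx My = coordSub-⊕ M x y Mx My

coordSub-isSubspace : ∀ {m} (M : Vec Bool m) → IsSubspace (coordSub M)
coordSub-isSubspace M = coordSub-zero M , coordSub-⊕ M

coordSub-all : ∀ {m} (x : Vec Bool m) → coordSub (replicate m true) x ≡ true
coordSub-all []      = refl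
coordSub-all (b ∷ x) = coordSub-all x

coordSub-none : ∀ {m} (x : Vec Bool m) → coordSub (replicate m false) x ≡ true → x ≡ zeroVec
coordSub-none []          _  = refl
coordSub-none (false ∷ x) x0 = cong (false ∷_) (coordSub-none x x0)

coordSize : ∀ {m} → Vec Bool m → ℕ
coordSize []          = 1
coordSize (true ∷ M)  = 2 ℕ.* coordSize M
coordSize (false ∷ M) = coordSize M

coordSize-complement : ∀ {m} (M : Vec Bool m) → coordSize M ℕ.* coordSize (complement M) ≡ 2 ^ m
coordSize-complement []          = refl
coordSize-complement (true ∷ M)  =
  trans (ℕP.*-assoc 2 (coordSize M) _) (cong (2 ℕ.*_) (coordSize-complement M))
coordSize-complement {suc m} (false ∷ M) = begin
  coordSize M ℕ.* (2 ℕ.* coordSize (complement M)) ≡⟨ ℕP.*-comm (coordSize M) _ ⟩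
  (2 ℕ.* coordSize (complement M)) ℕ.* coordSize M ≡⟨ ℕP.*-assoc 2 (coordSize (complement M)) _ ⟩
  2 ℕ.* (coordSize (complement M) ℕ.* coordSize M) ≡⟨ cong (2 ℕ.*_) (ℕP.*-comm (coordSize (complement M)) _) ⟩
  2 ℕ.* (coordSize M ℕ.* coordSize (complement M)) ≡⟨ cong (2 ℕ.*_) (coordSize-complement M) ⟩
  2 ^ suc m ∎
  where open ≡-Reasoning

maskA : ∀ m → ℕ → Vec Bool m
maskA m s = tabulate (λ i → not (s <ᵇ toℕ i ℕ.+ 1))

maskB : ∀ m → ℕ → Vec Bool m
maskB m s = tabulate (λ i → s <ᵇ toℕ i ℕ.+ 1)

private
  conjunction-tabulate : ∀ {m} (c : Fin m → Bool) (g : Bool → Bool → Bool) (k : Bool → Bool)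
    → (∀ a b → g a b ≡ (k a ∨ not b)) → (x : Vec Bool m)
    → V.foldr _ _∧_ true (tabulate (λ i → g (c i) (lookup x i))) ≡ coordSub (tabulate (k ∘ c)) x
  conjunction-tabulate c g k g≡ []      = refl
  conjunction-tabulate c g k g≡ (b ∷ x) =
    cong₂ _∧_ (g≡ (c zero) b) (conjunction-tabulate (c ∘ suc) g k g≡ x)

LA≗coordSub : ∀ {m} s (x : Vec Bool m) → LA s x ≡ coordSub (maskA m s) x
LA≗coordSub s =
  conjunction-tabulate (λ i → s <ᵇ toℕ i ℕ.+ 1) (λ a b → if a then not b else true) not λ { true _ → refl ; false _ → refl }

LB≗coordSub : ∀ {m} s (x : Vec Bool m) → LB s x ≡ coordSub (maskB m s) x
LB≗coordSub s =
  conjunction-tabulate (λ i → s <ᵇ toℕ i ℕ.+ 1) (λ a b → if a then true else not b) id λ { true _ → refl ; false _ → refl }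

conjunction-false : ∀ {m} (g : Vec Bool m → Bool) (z : Vec Bool m) → g z ≡ false
  → Conjunction.⨁ g ≡ false
conjunction-false {zero}  g []          gz = cong (_∧ true) gz
conjunction-false {suc m} g (false ∷ z) gz =
  trans (Conjunction.⨁-cons g)
    (cong (_∧ Conjunction.⨁ (λ y → g (true ∷ y))) (conjunction-false (λ y → g (false ∷ y)) z gz))
conjunction-false {suc m} g (true ∷ z)  gz =
  trans (Conjunction.⨁-cons g)
    (trans (cong (Conjunction.⨁ (λ y → g (false ∷ y)) ∧_) (conjunction-false (λ y → g (true ∷ y)) z gz))
      (∧-zeroʳ _))

perpInd-cong : ∀ {m} {L L′ : Subset m} → (∀ y → L y ≡ L′ y) → ∀ x → perpInd L x ≡ perpInd L′ x
perpInd-cong {m} L≗L′ x =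
  List.foldr-cong (λ y b → cong (λ l → (not l ∨ not (dot x y)) ∧ b) (L≗L′ y)) refl (allVecs m)

perpInd-coordSub : ∀ {m} (M x : Vec Bool m) → perpInd (coordSub M) x ≡ coordSub (complement M) x
perpInd-coordSub {m} M x =
  trans (sym (List.foldr-map _∧_ (orthogonal M x) true (allVecs m))) (conjunction M x)
  where
  orthogonal : ∀ {k} → Vec Bool k → Vec Bool k → Vec Bool k → Bool
  orthogonal M x y = not (coordSub M y) ∨ not (dot x y)

  conjunction : ∀ {k} (M x : Vec Bool k) → Conjunction.⨁ (orthogonal M x) ≡ coordSub (complement M) x
  conjunction []          []          = refl
  conjunction {suc k} (false ∷ M) (b ∷ x) = begin
    Conjunction.⨁ (orthogonal (false ∷ M) (b ∷ x))
      ≡⟨ Conjunction.⨁-cons (orthogonal (false ∷ M) (b ∷ x)) ⟩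
    Conjunction.⨁ (λ y → orthogonal (false ∷ M) (b ∷ x) (false ∷ y)) ∧ Conjunction.⨁ {k} (λ _ → true)
      ≡⟨ cong₂ _∧_ (Conjunction.⨁-cong (λ y → cong (λ t → not (coordSub M y) ∨ not (t xor dot x y)) (∧-zeroʳ b)))
                   (Conjunction.⨁-const-ε k) ⟩
    Conjunction.⨁ (orthogonal M x) ∧ true
      ≡⟨ trans (∧-identityʳ _) (conjunction M x) ⟩
    coordSub (complement M) x ∎
    where open ≡-Reasoning
  conjunction (true ∷ M)  (false ∷ x) =
    trans (Conjunction.⨁-cons (orthogonal (true ∷ M) (false ∷ x)))
      (trans (∧-idem _) (conjunction M x))
  conjunction (true ∷ M)  (true ∷ x)  =
    trans (Conjunction.⨁-cons (orthogonal (true ∷ M) (true ∷ x)))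
      (trans (cong (Conjunction.⨁ (orthogonal M x) ∧_)
                   (conjunction-false (λ y → orthogonal (true ∷ M) (true ∷ x) (true ∷ y)) zeroVec orthogonal-zero))
             (∧-zeroʳ _))
    where
    orthogonal-zero : not (coordSub M zeroVec) ∨ not (not (dot x zeroVec)) ≡ false
    orthogonal-zero rewrite coordSub-zero M | dot-zeroʳ x = refl

-- Character sums

module Sum = BigOperator ℤP.+-0-isCommutativeMonoid
open Sum using () renaming (⨁ to ∑)

ind : Bool → ℤ
ind true  = + 1
ind false = +0

sign-xor : ∀ a b → sign (a xor b) ≡ sign a * sign b
sign-xor false false = refl
sign-xor false true  = refl
sign-xor true  false = refl
sign-xor true  true  = refl

sign-xor-ind : ∀ a b → sign (a xor b) ≡ sign a + -[1+ 1 ] * (ind b * sign a)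
sign-xor-ind false false = refl
sign-xor-ind false true  = refl
sign-xor-ind true  false = refl
sign-xor-ind true  true  = refl

∣+n*sign∣ : ∀ n b → ℤ.∣ + n * sign b ∣ ≡ n
∣+n*sign∣ n b = trans (ℤP.abs-* (+ n) (sign b)) (trans (cong (n ℕ.*_) (∣sign∣ b)) (ℕP.*-identityʳ n))
  where
  ∣sign∣ : ∀ b → ℤ.∣ sign b ∣ ≡ 1
  ∣sign∣ false = refl
  ∣sign∣ true  = refl

∑-*ˡ : ∀ m c (g : Vec Bool m → ℤ) → ∑ (λ x → c * g x) ≡ c * ∑ g
∑-*ˡ zero    c g = trans (ℤP.+-identityʳ (c * g [])) (cong (c *_) (sym (ℤP.+-identityʳ (g []))))
∑-*ˡ (suc m) c g = begin
  ∑ (λ x → c * g x)                                           ≡⟨ Sum.⨁-cons (λ x → c * g x) ⟩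
  ∑ (λ x → c * g (false ∷ x)) + ∑ (λ x → c * g (true ∷ x))    ≡⟨ cong₂ _+_ (∑-*ˡ m c (λ x → g (false ∷ x)))
                                                                           (∑-*ˡ m c (λ x → g (true ∷ x))) ⟩
  c * ∑ (λ x → g (false ∷ x)) + c * ∑ (λ x → g (true ∷ x))    ≡⟨ sym (ℤP.*-distribˡ-+ c _ _) ⟩
  c * (∑ (λ x → g (false ∷ x)) + ∑ (λ x → g (true ∷ x)))      ≡⟨ cong (c *_) (sym (Sum.⨁-cons g)) ⟩
  c * ∑ g                                                     ∎
  where open ≡-Reasoning

∑-vanish : ∀ m (g : Vec Bool m → ℤ) → (∀ x → g x ≡ +0) → ∑ g ≡ +0
∑-vanish m g g≗0 = trans (Sum.⨁-cong g≗0) (Sum.⨁-const-ε m)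

∑-ind-vanish : ∀ m (D : Subset m) (g : Vec Bool m → ℤ) → (∀ y → D y ≢ true)
  → ∑ (λ y → ind (D y) * g y) ≡ +0
∑-ind-vanish m D g D≢true = ∑-vanish m (λ y → ind (D y) * g y) vanishes
  where
  vanishes : ∀ y → ind (D y) * g y ≡ +0
  vanishes y with D y in Dy
  ... | true  = ⊥-elim (D≢true y Dy)
  ... | false = refl

∑-delta : ∀ {m} (D : Subset m) (c : Vec Bool m) → (∀ y → D y ≡ true → y ≡ c) → D c ≡ true
  → (g : Vec Bool m → ℤ) → ∑ (λ y → ind (D y) * g y) ≡ g c
∑-delta {zero}  D [] _ Dc g rewrite Dc = trans (ℤP.+-identityʳ _) (ℤP.*-identityˡ (g []))
∑-delta {suc m} D (false ∷ c) unique Dc g = begin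
  ∑ (λ y → ind (D y) * g y)
    ≡⟨ Sum.⨁-cons (λ y → ind (D y) * g y) ⟩
  ∑ (λ y → ind (D (false ∷ y)) * g (false ∷ y)) + ∑ (λ y → ind (D (true ∷ y)) * g (true ∷ y))
    ≡⟨ cong₂ _+_ (∑-delta (D ∘ (false ∷_)) c (λ y → VP.∷-injectiveʳ ∘ unique (false ∷ y)) Dc (g ∘ (false ∷_)))
                 (∑-ind-vanish m (D ∘ (true ∷_)) (g ∘ (true ∷_)) (λ y → (λ ()) ∘ unique (true ∷ y))) ⟩
  g (false ∷ c) + +0
    ≡⟨ ℤP.+-identityʳ _ ⟩
  g (false ∷ c) ∎
  where open ≡-Reasoning
∑-delta {suc m} D (true ∷ c) unique Dc g = begin
  ∑ (λ y → ind (D y) * g y)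
    ≡⟨ Sum.⨁-cons (λ y → ind (D y) * g y) ⟩
  ∑ (λ y → ind (D (false ∷ y)) * g (false ∷ y)) + ∑ (λ y → ind (D (true ∷ y)) * g (true ∷ y))
    ≡⟨ cong₂ _+_ (∑-ind-vanish m (D ∘ (false ∷_)) (g ∘ (false ∷_)) (λ y → (λ ()) ∘ unique (false ∷ y)))
                 (∑-delta (D ∘ (true ∷_)) c (λ y → VP.∷-injectiveʳ ∘ unique (true ∷ y)) Dc (g ∘ (true ∷_))) ⟩
  +0 + g (true ∷ c)
    ≡⟨ ℤP.+-identityˡ _ ⟩
  g (true ∷ c) ∎
  where open ≡-Reasoning

private
  does-sound : ∀ {P : Set} (d : Dec P) → does d ≡ true → P
  does-sound (yes p) _ = p

_≟ᵥ_ : ∀ {m} (x y : Vec Bool m) → Dec (x ≡ y)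
_≟ᵥ_ = VP.≡-dec Bool._≟_

∑-reindex : ∀ {m} (π σ : Vec Bool m → Vec Bool m) → (∀ z → π (σ z) ≡ z) → (∀ y → σ (π y) ≡ y)
  → (g : Vec Bool m → ℤ) → ∑ (λ y → g (π y)) ≡ ∑ g
∑-reindex {m} π σ πσ σπ g = begin
  ∑ (λ y → g (π y))                          ≡⟨ Sum.⨁-cong (λ y → sym (at-π y)) ⟩
  ∑ (λ y → ∑ (λ z → ind (hits y z) * g z))  ≡⟨ Sum.⨁-swap (λ y z → ind (hits y z) * g z) ⟩
  ∑ (λ z → ∑ (λ y → ind (hits y z) * g z))  ≡⟨ Sum.⨁-cong at-σ ⟩
  ∑ g                                        ∎
  where
  open ≡-Reasoning
  hits : Vec Bool m → Vec Bool m → Bool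
  hits y z = does (z ≟ᵥ π y)
  at-π : ∀ y → ∑ (λ z → ind (hits y z) * g z) ≡ g (π y)
  at-π y = ∑-delta (hits y) (π y) (λ z → does-sound (z ≟ᵥ π y)) (dec-true (π y ≟ᵥ π y) refl) g
  at-σ : ∀ z → ∑ (λ y → ind (hits y z) * g z) ≡ g z
  at-σ z = ∑-delta (λ y → hits y z) (σ z)
    (λ y z≡πy → trans (sym (σπ y)) (cong σ (sym (does-sound (z ≟ᵥ π y) z≡πy))))
    (dec-true (z ≟ᵥ π (σ z)) (sym (πσ z))) (λ _ → g z)

∑-ind-sign-coordSub : ∀ {m} (N w : Vec Bool m)
  → ∑ (λ x → ind (coordSub N x) * sign (dot x w)) ≡ + coordSize N * ind (coordSub (complement N) w)
∑-ind-sign-coordSub []          []      = refl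
∑-ind-sign-coordSub {suc m} (false ∷ N) (b ∷ w) = begin
  ∑ (λ x → ind (coordSub (false ∷ N) x) * sign (dot x (b ∷ w)))
    ≡⟨ Sum.⨁-cons (λ x → ind (coordSub (false ∷ N) x) * sign (dot x (b ∷ w))) ⟩
  ∑ (λ x → ind (coordSub N x) * sign (dot x w)) + ∑ {m} (λ _ → +0)
    ≡⟨ cong₂ _+_ (∑-ind-sign-coordSub N w) (Sum.⨁-const-ε m) ⟩
  + coordSize N * ind (coordSub (complement N) w) + +0
    ≡⟨ ℤP.+-identityʳ _ ⟩
  + coordSize N * ind (coordSub (complement N) w) ∎
  where open ≡-Reasoning
∑-ind-sign-coordSub (true ∷ N) (false ∷ w) = begin
  ∑ (λ x → ind (coordSub (true ∷ N) x) * sign (dot x (false ∷ w)))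
    ≡⟨ Sum.⨁-cons (λ x → ind (coordSub (true ∷ N) x) * sign (dot x (false ∷ w))) ⟩
  S + S
    ≡⟨ cong₂ _+_ (∑-ind-sign-coordSub N w) (∑-ind-sign-coordSub N w) ⟩
  + n * i + + n * i
    ≡⟨ double (+ n) i ⟩
  + 2 * + n * i
    ≡⟨ cong (_* i) (sym (ℤP.pos-* 2 n)) ⟩
  + (2 ℕ.* n) * i ∎
  where
  open ≡-Reasoning
  S = ∑ (λ x → ind (coordSub N x) * sign (dot x w))
  n = coordSize N
  i = ind (coordSub (complement N) w)
  double : ∀ a b → a * b + a * b ≡ + 2 * a * b
  double = solve-∀
∑-ind-sign-coordSub (true ∷ N) (true ∷ w) = begin
  ∑ (λ x → ind (coordSub (true ∷ N) x) * sign (dot x (true ∷ w)))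
    ≡⟨ Sum.⨁-cons (λ x → ind (coordSub (true ∷ N) x) * sign (dot x (true ∷ w))) ⟩
  S + ∑ (λ x → ind (coordSub N x) * sign (true xor dot x w))
    ≡⟨ cong (λ t → S + t) (trans (Sum.⨁-cong (λ x → cong (ind (coordSub N x) *_) (sign-xor true (dot x w))))
                          (trans (Sum.⨁-cong (λ x → flip (ind (coordSub N x)) (sign (dot x w))))
                                 (∑-*ˡ _ (-[1+ 0 ]) (λ x → ind (coordSub N x) * sign (dot x w))))) ⟩
  S + -[1+ 0 ] * S
    ≡⟨ cancel S ⟩
  +0
    ≡⟨ sym (ℤP.*-zeroʳ (+ coordSize (true ∷ N))) ⟩
  + coordSize (true ∷ N) * +0 ∎
  where
  open ≡-Reasoning
  S = ∑ (λ x → ind (coordSub N x) * sign (dot x w))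
  flip : ∀ a s → a * (-[1+ 0 ] * s) ≡ -[1+ 0 ] * (a * s)
  flip = solve-∀
  cancel : ∀ s → s + -[1+ 0 ] * s ≡ +0
  cancel = solve-∀

∑-ind-coordSub : ∀ {m} (N : Vec Bool m) → ∑ (λ x → ind (coordSub N x)) ≡ + coordSize N
∑-ind-coordSub N = begin
  ∑ (λ x → ind (coordSub N x))
    ≡⟨ Sum.⨁-cong (λ x → sym (trans (cong (λ b → ind (coordSub N x) * sign b) (dot-zeroʳ x)) (ℤP.*-identityʳ _))) ⟩
  ∑ (λ x → ind (coordSub N x) * sign (dot x zeroVec))
    ≡⟨ ∑-ind-sign-coordSub N zeroVec ⟩
  + coordSize N * ind (coordSub (complement N) zeroVec)
    ≡⟨ trans (cong (λ b → + coordSize N * ind b) (coordSub-zero (complement N))) (ℤP.*-identityʳ _) ⟩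
  + coordSize N ∎
  where open ≡-Reasoning

∑-sign-dot : ∀ {m} (w : Vec Bool m) → ∑ (λ x → sign (dot x w)) ≡ + 2 ^ m * ind (coordSub (replicate m false) w)
∑-sign-dot {m} w = begin
  ∑ (λ x → sign (dot x w))
    ≡⟨ Sum.⨁-cong (λ x → sym (trans (cong (λ b → ind b * sign (dot x w)) (coordSub-all x)) (ℤP.*-identityˡ _))) ⟩
  ∑ (λ x → ind (coordSub all x) * sign (dot x w))
    ≡⟨ ∑-ind-sign-coordSub all w ⟩
  + coordSize all * ind (coordSub (complement all) w)
    ≡⟨ cong₂ (λ n M → + n * ind (coordSub M w)) (coordSize-all m) (VP.map-replicate not true m) ⟩
  + 2 ^ m * ind (coordSub (replicate m false) w) ∎
  where
  open ≡-Reasoning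
  all = replicate m true
  coordSize-all : ∀ m → coordSize (replicate m true) ≡ 2 ^ m
  coordSize-all zero    = refl
  coordSize-all (suc m) = cong (2 ℕ.*_) (coordSize-all m)

∑-sign-dot-xor-coordSub : ∀ {m} (N w : Vec Bool m) → ∑ (λ x → sign (dot x w xor coordSub N x))
  ≡ + 2 ^ m * ind (coordSub (replicate m false) w) + -[1+ 1 ] * (+ coordSize N * ind (coordSub (complement N) w))
∑-sign-dot-xor-coordSub {m} N w = begin
  ∑ (λ x → sign (dot x w xor coordSub N x))
    ≡⟨ Sum.⨁-cong (λ x → sign-xor-ind (dot x w) (coordSub N x)) ⟩
  ∑ (λ x → sign (dot x w) + -[1+ 1 ] * (ind (coordSub N x) * sign (dot x w)))
    ≡⟨ Sum.⨁-∙ m (λ x → sign (dot x w)) (λ x → -[1+ 1 ] * (ind (coordSub N x) * sign (dot x w))) ⟩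
  ∑ (λ x → sign (dot x w)) + ∑ (λ x → -[1+ 1 ] * (ind (coordSub N x) * sign (dot x w)))
    ≡⟨ cong₂ _+_ (∑-sign-dot w) (∑-*ˡ m -[1+ 1 ] (λ x → ind (coordSub N x) * sign (dot x w))) ⟩
  + 2 ^ m * ind (coordSub (replicate m false) w) + -[1+ 1 ] * ∑ (λ x → ind (coordSub N x) * sign (dot x w))
    ≡⟨ cong (λ t → + 2 ^ m * ind (coordSub (replicate m false) w) + -[1+ 1 ] * t) (∑-ind-sign-coordSub N w) ⟩
  + 2 ^ m * ind (coordSub (replicate m false) w) + -[1+ 1 ] * (+ coordSize N * ind (coordSub (complement N) w)) ∎
  where open ≡-Reasoning

subspace-translate : ∀ {m} {V : Subset m} → IsSubspace V → ∀ {t} → V t ≡ true → ∀ y → V (y ⊕ t) ≡ V y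
subspace-translate {V = V} (_ , V-⊕) {t} Vt y with V y in Vy
... | true  = V-⊕ y t Vy Vt
... | false with V (y ⊕ t) in Vyt
...   | false = refl
...   | true  = case trans (sym Vy) (subst (λ v → V v ≡ true) (⊕-cancelʳ y t) (V-⊕ _ t Vyt Vt)) of λ ()

∑-coset : ∀ {m} (V : Subset m) (c u : Vec Bool m)
  → ∑ (λ y → ind (V (y ⊕ c)) * sign (dot u y)) ≡ sign (dot u c) * ∑ (λ y → ind (V y) * sign (dot u y))
∑-coset {m} V c u = begin
  ∑ (λ y → ind (V (y ⊕ c)) * sign (dot u y))
    ≡⟨ sym (Sum.⨁-translate m (λ y → ind (V (y ⊕ c)) * sign (dot u y)) c) ⟩
  ∑ (λ y → ind (V ((y ⊕ c) ⊕ c)) * sign (dot u (y ⊕ c)))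
    ≡⟨ Sum.⨁-cong shifted ⟩
  ∑ (λ y → sign (dot u c) * (ind (V y) * sign (dot u y)))
    ≡⟨ ∑-*ˡ m (sign (dot u c)) (λ y → ind (V y) * sign (dot u y)) ⟩
  sign (dot u c) * ∑ (λ y → ind (V y) * sign (dot u y)) ∎
  where
  open ≡-Reasoning
  rearrange : ∀ i s t → i * (s * t) ≡ t * (i * s)
  rearrange = solve-∀
  shifted : ∀ y → ind (V ((y ⊕ c) ⊕ c)) * sign (dot u (y ⊕ c)) ≡ sign (dot u c) * (ind (V y) * sign (dot u y))
  shifted y = begin
    ind (V ((y ⊕ c) ⊕ c)) * sign (dot u (y ⊕ c))
      ≡⟨ cong₂ (λ v b → ind (V v) * sign b) (⊕-cancelʳ y c) (dot-⊕ʳ u y c) ⟩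
    ind (V y) * sign (dot u y xor dot u c)
      ≡⟨ cong (ind (V y) *_) (sign-xor (dot u y) (dot u c)) ⟩
    ind (V y) * (sign (dot u y) * sign (dot u c))
      ≡⟨ rearrange (ind (V y)) (sign (dot u y)) (sign (dot u c)) ⟩
    sign (dot u c) * (ind (V y) * sign (dot u y)) ∎

-- Translating by y ∈ V multiplies the sum by (-1)^(u·y), so a nonzero sum forces u ⊥ V.
∑-subspace-vanishes-or-orthogonal : ∀ {m} {V : Subset m} → IsSubspace V → (u : Vec Bool m)
  → ∑ (λ y → ind (V y) * sign (dot u y)) ≡ +0 ⊎ (∀ y → V y ≡ true → dot u y ≡ false)
∑-subspace-vanishes-or-orthogonal {m} {V} V-subspace u with ∑ (λ y → ind (V y) * sign (dot u y)) ℤ.≟ +0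
... | yes T≡0 = inj₁ T≡0
... | no  T≢0 = inj₂ orthogonal
  where
  T = ∑ (λ y → ind (V y) * sign (dot u y))
  invariant : ∀ y → V y ≡ true → T ≡ sign (dot u y) * T
  invariant y Vy = trans (Sum.⨁-cong (λ v → cong (λ b → ind b * sign (dot u v)) (sym (subspace-translate V-subspace Vy v))))
                         (∑-coset V y u)
  orthogonal : ∀ y → V y ≡ true → dot u y ≡ false
  orthogonal y Vy with dot u y in uy
  ... | false = refl
  ... | true  = ⊥-elim (T≢0 (self-negating T (subst (λ b → T ≡ sign b * T) uy (invariant y Vy))))
    where
    self-negating : ∀ t → t ≡ -[1+ 0 ] * t → t ≡ +0
    self-negating +0       _  = refl
    self-negating +[1+ n ] ()
    self-negating -[1+ n ] ()

∑-orthogonal : ∀ {m} (V : Subset m) (u : Vec Bool m) → (∀ y → V y ≡ true → dot u y ≡ false)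
  → ∑ (λ y → ind (V y) * sign (dot u y)) ≡ ∑ (λ y → ind (V y))
∑-orthogonal V u orthogonal = Sum.⨁-cong pointwise
  where
  pointwise : ∀ y → ind (V y) * sign (dot u y) ≡ ind (V y)
  pointwise y with V y in Vy
  ... | true  = cong (λ b → + 1 * sign b) (orthogonal y Vy)
  ... | false = refl

-- Walsh coefficients of f_(π,L)

walsh-fC : ∀ {m} (π : Vec Bool m → Vec Bool m) (L : Subset m) (u₁ u₂ : Vec Bool m)
  → walsh (fC π L) u₁ u₂ ≡ ∑ (λ y → sign (dot u₂ y) * ∑ (λ x → sign (dot x (π y ⊕ u₁) xor perpInd L x)))
walsh-fC {m} π L u₁ u₂ = begin
  walsh (fC π L) u₁ u₂
    ≡⟨ Sum.foldr-concatMap F (allVecs m) (allVecs m) ⟩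
  ∑ (λ x → ∑ (λ y → F x y))
    ≡⟨ Sum.⨁-swap F ⟩
  ∑ (λ y → ∑ (λ x → F x y))
    ≡⟨ Sum.⨁-cong (λ y → Sum.⨁-cong (λ x → regroup x y)) ⟩
  ∑ (λ y → ∑ (λ x → sign (dot u₂ y) * sign (dot x (π y ⊕ u₁) xor perpInd L x)))
    ≡⟨ Sum.⨁-cong (λ y → ∑-*ˡ m (sign (dot u₂ y)) (λ x → sign (dot x (π y ⊕ u₁) xor perpInd L x))) ⟩
  ∑ (λ y → sign (dot u₂ y) * ∑ (λ x → sign (dot x (π y ⊕ u₁) xor perpInd L x))) ∎
  where
  open ≡-Reasoning
  F : Vec Bool m → Vec Bool m → ℤ
  F x y = sign (fC π L x y xor (dot u₁ x xor dot u₂ y))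
  rearrange : ∀ a p b c → (a * p) * (b * c) ≡ c * ((a * b) * p)
  rearrange = solve-∀
  -- sign turns xor into a product, so the ring solver on ℤ does the regrouping
  sign-regroup : ∀ a p b c → sign ((a xor p) xor (b xor c)) ≡ sign c * sign ((a xor b) xor p)
  sign-regroup a p b c = begin
    sign ((a xor p) xor (b xor c))
      ≡⟨ trans (sign-xor (a xor p) (b xor c)) (cong₂ _*_ (sign-xor a p) (sign-xor b c)) ⟩
    (sign a * sign p) * (sign b * sign c)
      ≡⟨ rearrange (sign a) (sign p) (sign b) (sign c) ⟩
    sign c * ((sign a * sign b) * sign p)
      ≡⟨ cong (sign c *_) (sym (trans (sign-xor (a xor b) p) (cong (_* sign p) (sign-xor a b)))) ⟩
    sign c * sign ((a xor b) xor p) ∎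
  regroup : ∀ x y → F x y ≡ sign (dot u₂ y) * sign (dot x (π y ⊕ u₁) xor perpInd L x)
  regroup x y = trans (sign-regroup (dot x (π y)) (perpInd L x) (dot u₁ x) (dot u₂ y))
    (cong (λ d → sign (dot u₂ y) * sign (d xor perpInd L x))
          (trans (cong (dot x (π y) xor_) (dot-comm u₁ x)) (sym (dot-⊕ʳ x (π y) u₁))))

∣n*n̄*s-2*n̄*s*n∣ : ∀ n n̄ b → ℤ.∣ + (n ℕ.* n̄) * sign b + -[1+ 1 ] * + n̄ * (sign b * + n) ∣ ≡ n ℕ.* n̄
∣n*n̄*s-2*n̄*s*n∣ n n̄ b = begin
  ℤ.∣ + (n ℕ.* n̄) * s + -[1+ 1 ] * + n̄ * (s * + n) ∣  ≡⟨ cong (λ k → ℤ.∣ k * s + -[1+ 1 ] * + n̄ * (s * + n) ∣) (ℤP.pos-* n n̄) ⟩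
  ℤ.∣ + n * + n̄ * s + -[1+ 1 ] * + n̄ * (s * + n) ∣    ≡⟨ cong ℤ.∣_∣ (collapse (+ n) (+ n̄) s) ⟩
  ℤ.∣ - (+ n * + n̄ * s) ∣                              ≡⟨ ℤP.∣-i∣≡∣i∣ (+ n * + n̄ * s) ⟩
  ℤ.∣ + n * + n̄ * s ∣                                  ≡⟨ cong (λ k → ℤ.∣ k * s ∣) (sym (ℤP.pos-* n n̄)) ⟩
  ℤ.∣ + (n ℕ.* n̄) * s ∣                                ≡⟨ ∣+n*sign∣ (n ℕ.* n̄) b ⟩
  n ℕ.* n̄                                              ∎
  where
  open ≡-Reasoning
  s = sign b
  collapse : ∀ a b s → a * b * s + -[1+ 1 ] * b * (s * a) ≡ - (a * b * s)
  collapse = solve-∀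

module _ {m} (π σ : Vec Bool m → Vec Bool m) (πσ : ∀ z → π (σ z) ≡ z) (σπ : ∀ y → σ (π y) ≡ y)
         (M : Vec Bool m) {L : Subset m} (L≗M : ∀ x → L x ≡ coordSub M x) where

  ∑-sign-dot-xor-perpInd : ∀ w → ∑ (λ x → sign (dot x w xor perpInd L x))
    ≡ + 2 ^ m * ind (coordSub (replicate m false) w) + -[1+ 1 ] * (+ coordSize (complement M) * ind (L w))
  ∑-sign-dot-xor-perpInd w = begin
    ∑ (λ x → sign (dot x w xor perpInd L x))
      ≡⟨ Sum.⨁-cong (λ x → cong (λ b → sign (dot x w xor b)) (trans (perpInd-cong L≗M x) (perpInd-coordSub M x))) ⟩
    ∑ (λ x → sign (dot x w xor coordSub (complement M) x))
      ≡⟨ ∑-sign-dot-xor-coordSub (complement M) w ⟩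
    A + B (coordSub (complement (complement M)) w)
      ≡⟨ cong (λ N → A + B (coordSub N w)) (complement-involutive M) ⟩
    A + B (coordSub M w)
      ≡⟨ cong (λ b → A + B b) (sym (L≗M w)) ⟩
    A + B (L w) ∎
    where
    open ≡-Reasoning
    A = + 2 ^ m * ind (coordSub (replicate m false) w)
    B : Bool → ℤ
    B b = -[1+ 1 ] * (+ coordSize (complement M) * ind b)

  ∑-ind-π-root : ∀ u (g : Vec Bool m → ℤ) → ∑ (λ y → ind (coordSub (replicate m false) (π y ⊕ u)) * g y) ≡ g (σ u)
  ∑-ind-π-root u g = ∑-delta (λ y → coordSub (replicate m false) (π y ⊕ u)) (σ u)
    (λ y π-root → trans (sym (σπ y)) (cong σ (⊕≡zero⇒≡ (π y) u (coordSub-none (π y ⊕ u) π-root))))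
    (subst (λ v → coordSub (replicate m false) v ≡ true) (sym (trans (cong (_⊕ u) (πσ u)) (⊕-self u)))
           (coordSub-zero (replicate m false)))
    g

  module _ (u₁ : Vec Bool m) (c : Vec Bool m) (V : Subset m) (preimage≗ : ∀ y → L (π y ⊕ u₁) ≡ V (y ⊕ c)) where

    walsh-fC-flat : ∀ u₂ → walsh (fC π L) u₁ u₂
      ≡ + 2 ^ m * sign (dot u₂ (σ u₁))
        + -[1+ 1 ] * + coordSize (complement M) * (sign (dot u₂ c) * ∑ (λ y → ind (V y) * sign (dot u₂ y)))
    walsh-fC-flat u₂ = begin
      walsh (fC π L) u₁ u₂
        ≡⟨ walsh-fC π L u₁ u₂ ⟩
      ∑ (λ y → s y * ∑ (λ x → sign (dot x (π y ⊕ u₁) xor perpInd L x)))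
        ≡⟨ Sum.⨁-cong (λ y → trans (cong (s y *_) (∑-sign-dot-xor-perpInd (π y ⊕ u₁)))
                                   (expand (s y) (ind (Z (π y ⊕ u₁))) (ind (L (π y ⊕ u₁))))) ⟩
      ∑ (λ y → A * (ind (Z (π y ⊕ u₁)) * s y) + B * (ind (L (π y ⊕ u₁)) * s y))
        ≡⟨ Sum.⨁-∙ m (λ y → A * (ind (Z (π y ⊕ u₁)) * s y)) (λ y → B * (ind (L (π y ⊕ u₁)) * s y)) ⟩
      ∑ (λ y → A * (ind (Z (π y ⊕ u₁)) * s y)) + ∑ (λ y → B * (ind (L (π y ⊕ u₁)) * s y))
        ≡⟨ cong₂ _+_ (∑-*ˡ m A (λ y → ind (Z (π y ⊕ u₁)) * s y)) (∑-*ˡ m B (λ y → ind (L (π y ⊕ u₁)) * s y)) ⟩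
      A * ∑ (λ y → ind (Z (π y ⊕ u₁)) * s y) + B * ∑ (λ y → ind (L (π y ⊕ u₁)) * s y)
        ≡⟨ cong₂ (λ p q → A * p + B * q) (∑-ind-π-root u₁ s)
                 (trans (Sum.⨁-cong (λ y → cong (λ b → ind b * s y) (preimage≗ y))) (∑-coset V c u₂)) ⟩
      A * s (σ u₁) + B * (s c * ∑ (λ y → ind (V y) * s y)) ∎
      where
      open ≡-Reasoning
      s : Vec Bool m → ℤ
      s y = sign (dot u₂ y)
      Z = coordSub (replicate m false)
      A = + 2 ^ m
      n̄ = + coordSize (complement M)
      B = -[1+ 1 ] * n̄
      ring : ∀ s i j A n → s * (A * i + -[1+ 1 ] * (n * j)) ≡ A * (i * s) + (-[1+ 1 ] * n) * (j * s)
      ring = solve-∀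
      expand : ∀ s i j → s * (A * i + -[1+ 1 ] * (n̄ * j)) ≡ A * (i * s) + B * (j * s)
      expand s i j = ring s i j A n̄

    flat-size : ∑ (λ y → ind (V y)) ≡ + coordSize M
    flat-size = begin
      ∑ (λ y → ind (V y))               ≡⟨ sym (Sum.⨁-translate m (ind ∘ V) c) ⟩
      ∑ (λ y → ind (V (y ⊕ c)))         ≡⟨ Sum.⨁-cong (λ y → cong ind (sym (preimage≗ y))) ⟩
      ∑ (λ y → ind (L (π y ⊕ u₁)))      ≡⟨ ∑-reindex π σ πσ σπ (λ z → ind (L (z ⊕ u₁))) ⟩
      ∑ (λ z → ind (L (z ⊕ u₁)))        ≡⟨ Sum.⨁-translate m (ind ∘ L) u₁ ⟩
      ∑ (λ z → ind (L z))               ≡⟨ Sum.⨁-cong (cong ind ∘ L≗M) ⟩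
      ∑ (λ z → ind (coordSub M z))      ≡⟨ ∑-ind-coordSub M ⟩
      + coordSize M                     ∎
      where open ≡-Reasoning

    flat-∋σ : V (σ u₁ ⊕ c) ≡ true
    flat-∋σ = begin
      V (σ u₁ ⊕ c)          ≡⟨ sym (preimage≗ (σ u₁)) ⟩
      L (π (σ u₁) ⊕ u₁)     ≡⟨ cong L (trans (cong (_⊕ u₁) (πσ u₁)) (⊕-self u₁)) ⟩
      L zeroVec             ≡⟨ trans (L≗M zeroVec) (coordSub-zero M) ⟩
      true                  ∎
      where open ≡-Reasoning

  CCondition⇒isBent : CCondition π L → IsBent (fC π L)
  CCondition⇒isBent cc u₁ u₂ with cc u₁
  ... | c , V , V-subspace , preimage≗ with ∑-subspace-vanishes-or-orthogonal V-subspace u₂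
  ...   | inj₁ T≡0 = begin
    ℤ.∣ walsh (fC π L) u₁ u₂ ∣
      ≡⟨ cong ℤ.∣_∣ (trans (walsh-fC-flat u₁ c V preimage≗ u₂) (cong (λ t → A * s₁ + B * (s₂ * t)) T≡0)) ⟩
    ℤ.∣ A * s₁ + B * (s₂ * +0) ∣
      ≡⟨ cong ℤ.∣_∣ (drop A s₁ B s₂) ⟩
    ℤ.∣ A * s₁ ∣
      ≡⟨ ∣+n*sign∣ (2 ^ m) (dot u₂ (σ u₁)) ⟩
    2 ^ m ∎
    where
    open ≡-Reasoning
    A = + 2 ^ m
    B = -[1+ 1 ] * + coordSize (complement M)
    s₁ = sign (dot u₂ (σ u₁))
    s₂ = sign (dot u₂ c)
    drop : ∀ a s b t → a * s + b * (t * +0) ≡ a * s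
    drop = solve-∀
  ...   | inj₂ u₂⊥V = begin
    ℤ.∣ walsh (fC π L) u₁ u₂ ∣
      ≡⟨ cong ℤ.∣_∣ (walsh-fC-flat u₁ c V preimage≗ u₂) ⟩
    ℤ.∣ + 2 ^ m * sign (dot u₂ (σ u₁)) + B * (s * ∑ (λ y → ind (V y) * sign (dot u₂ y))) ∣
      ≡⟨ cong₂ (λ b t → ℤ.∣ + 2 ^ m * sign b + B * (s * t) ∣) same-sign
               (trans (∑-orthogonal V u₂ u₂⊥V) (flat-size u₁ c V preimage≗)) ⟩
    ℤ.∣ + 2 ^ m * s + B * (s * + n) ∣
      ≡⟨ cong (λ k → ℤ.∣ + k * s + B * (s * + n) ∣) (sym (coordSize-complement M)) ⟩
    ℤ.∣ + (n ℕ.* n̄) * s + B * (s * + n) ∣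
      ≡⟨ ∣n*n̄*s-2*n̄*s*n∣ n n̄ (dot u₂ c) ⟩
    n ℕ.* n̄
      ≡⟨ coordSize-complement M ⟩
    2 ^ m ∎
    where
    open ≡-Reasoning
    n  = coordSize M
    n̄  = coordSize (complement M)
    B  = -[1+ 1 ] * + n̄
    s  = sign (dot u₂ c)
    same-sign : dot u₂ (σ u₁) ≡ dot u₂ c
    same-sign = xor≡false⇒≡ (trans (sym (dot-⊕ʳ u₂ (σ u₁) c)) (u₂⊥V (σ u₁ ⊕ c) (flat-∋σ u₁ c V preimage≗)))
      where
      xor≡false⇒≡ : ∀ {a b} → a xor b ≡ false → a ≡ b
      xor≡false⇒≡ {false} {false} _ = refl
      xor≡false⇒≡ {true}  {true}  _ = refl

-- The polynomial P along a coordinate subspace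

AffineAlong : ∀ {n} → Subset n → (Vec Bool n → Bool) → Set
AffineAlong {n} W f = ∀ (x y z : Vec Bool n) → W (x ⊕ y) ≡ true → W (x ⊕ z) ≡ true
  → f ((x ⊕ y) ⊕ z) ≡ (f x xor f y) xor f z

VariesAlong : ∀ {n} → Subset n → (Vec Bool n → Bool) → Set
VariesAlong {n} W f = Σ (Vec Bool n) λ u → Σ (Vec Bool n) λ w → (W (u ⊕ w) ≡ true) × (f u xor f w ≡ true)

NonAffineAlong : ∀ {n} → Subset n → (Vec Bool n → Bool) → Set
NonAffineAlong {n} W f = Σ (Vec Bool n) λ x → Σ (Vec Bool n) λ y → Σ (Vec Bool n) λ z →
  (W (x ⊕ y) ≡ true) × (W (x ⊕ z) ≡ true) × (f ((x ⊕ y) ⊕ z) xor ((f x xor f y) xor f z) ≡ true)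

nonAffineAlong⇒¬affineAlong : ∀ {n} {W : Subset n} {f : Vec Bool n → Bool}
  → NonAffineAlong W f → ¬ AffineAlong W f
nonAffineAlong⇒¬affineAlong {f = f} (x , y , z , x~y , x~z , defect) affine =
  case trans (sym defect) (trans (cong (_xor ((f x xor f y) xor f z)) (affine x y z x~y x~z))
                                 (xor-same ((f x xor f y) xor f z))) of λ ()

overlapSize : ∀ {n} → Vec Bool n → Vec Bool n → ℕ
overlapSize []      []      = 0
overlapSize (s ∷ S) (h ∷ H) = (if s ∧ h then 1 else 0) ℕ.+ overlapSize S H

highCount≡overlapSize : ∀ {n} s (S : Vec Bool n) → highCount (suc s) S ≡ overlapSize S (maskB n s)
highCount≡overlapSize s S = trans (count S (λ j → suc s <ᵇ toℕ j ℕ.+ 2))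
  (cong (overlapSize S) (VP.tabulate-cong (λ j → cong (suc s <ᵇ_) (ℕP.+-suc (toℕ j) 1))))
  where
  count : ∀ {n} (S : Vec Bool n) (h : Fin n → Bool)
    → V.sum (tabulate (λ j → if lookup S j ∧ h j then 1 else 0)) ≡ overlapSize S (tabulate h)
  count []      h = refl
  count (b ∷ S) h = cong ((if b ∧ h zero then 1 else 0) ℕ.+_) (count S (h ∘ suc))

-- coefficients of x ↦ P (c ∷ x); at X₁ = 1 the monomials X_S and X₁ X_S merge
slice : ∀ {n} → (Vec Bool (suc n) → Bool) → Bool → Vec Bool n → Bool
slice α false S = α (false ∷ S)
slice α true  S = α (false ∷ S) xor α (true ∷ S)

polyP-xor : ∀ {n} (α β : Vec Bool n → Bool) (x : Vec Bool n)
  → polyP α x xor polyP β x ≡ polyP (λ S → α S xor β S) x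
polyP-xor {n} α β x = sym (trans
  (XorSum.⨁-cong (λ S → ∧-distribʳ-xor (monomial S x) (α S) (β S)))
  (XorSum.⨁-∙ n (λ S → α S ∧ monomial S x) (λ S → β S ∧ monomial S x)))

polyP-slice : ∀ {n} (α : Vec Bool (suc n) → Bool) (c : Bool) (x : Vec Bool n)
  → polyP α (c ∷ x) ≡ polyP (slice α c) x
polyP-slice {n} α c x = trans (XorSum.⨁-cons (λ S → α S ∧ monomial S (c ∷ x))) (halves c)
  where
  halves : ∀ c → polyP (slice α false) x xor XorSum.⨁ (λ S → α (true ∷ S) ∧ (c ∧ monomial S x))
               ≡ polyP (slice α c) x
  halves false = trans (cong (polyP (slice α false) x xor_)
                             (trans (XorSum.⨁-cong (λ S → ∧-zeroʳ (α (true ∷ S)))) (XorSum.⨁-const-ε n)))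
                       (xor-identityʳ _)
  halves true  = polyP-xor (slice α false) (λ S → α (true ∷ S)) x

polyP-derivative : ∀ {n} (α : Vec Bool (suc n) → Bool) (x : Vec Bool n)
  → polyP α (false ∷ x) xor polyP α (true ∷ x) ≡ polyP (λ S → α (true ∷ S)) x
polyP-derivative α x = begin
  polyP α (false ∷ x) xor polyP α (true ∷ x)
    ≡⟨ cong₂ _xor_ (polyP-slice α false x) (trans (polyP-slice α true x) (sym (polyP-xor α₀ α₁ x))) ⟩
  polyP α₀ x xor (polyP α₀ x xor polyP α₁ x)
    ≡⟨ xor-cancelˡ (polyP α₀ x) (polyP α₁ x) ⟩
  polyP α₁ x ∎
  where
  open ≡-Reasoning
  α₀ α₁ : _ → Bool
  α₀ S = α (false ∷ S)
  α₁ S = α (true ∷ S)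

slice-coefficient : ∀ {n} (α : Vec Bool (suc n) → Bool) (b : Bool) (S : Vec Bool n)
  → α (b ∷ S) ≡ true → ∃ λ c → slice α c S ≡ true
slice-coefficient α false S αS = false , αS
slice-coefficient α true  S αS with α (false ∷ S) in α₀S
... | true  = false , α₀S
... | false = true , trans (cong (_xor α (true ∷ S)) α₀S) αS

polyP-nonzero : ∀ {n} (α : Vec Bool n → Bool) (S : Vec Bool n) → α S ≡ true → ∃ λ x → polyP α x ≡ true
polyP-nonzero α []      αS = [] , cong (λ b → (b ∧ true) xor false) αS
polyP-nonzero α (b ∷ S) αS with slice-coefficient α b S αS
... | c , sliceS with polyP-nonzero (slice α c) S sliceS
...   | x , Px = c ∷ x , trans (polyP-slice α c x) Px

monomial-constantAlong : ∀ {n} (S H x w : Vec Bool n) → overlapSize S H ≡ 0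
  → coordSub H (x ⊕ w) ≡ true → monomial S x ≡ monomial S w
monomial-constantAlong []          []          []       []       _  _ = refl
monomial-constantAlong (false ∷ S) (h ∷ H)     (_ ∷ x)  (_ ∷ w)  o₀ x~w =
  monomial-constantAlong S H x w o₀ (∧-true₂ x~w)
monomial-constantAlong (true ∷ S)  (false ∷ H) (a ∷ x)  (b ∷ w)  o₀ x~w =
  cong₂ _∧_ (not-xor-true⇒≡ a b (∧-true₁ x~w)) (monomial-constantAlong S H x w o₀ (∧-true₂ x~w))

monomial-affineAlong : ∀ {n} (S H : Vec Bool n) → overlapSize S H ≤ 1 → AffineAlong (coordSub H) (monomial S)
monomial-affineAlong []          []          _  []      []      []      _    _    = refl
monomial-affineAlong (false ∷ S) (h ∷ H)     o₁ (_ ∷ x) (_ ∷ y) (_ ∷ z) x~y x~z =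
  monomial-affineAlong S H o₁ x y z (∧-true₂ x~y) (∧-true₂ x~z)
monomial-affineAlong (true ∷ S)  (false ∷ H) o₁ (a ∷ x) (b ∷ y) (c ∷ z) x~y x~z
  with not-xor-true⇒≡ a b (∧-true₁ x~y) | not-xor-true⇒≡ a c (∧-true₁ x~z)
... | refl | refl =
  trans (cong (((a xor a) xor a) ∧_) (monomial-affineAlong S H o₁ x y z (∧-true₂ x~y) (∧-true₂ x~z)))
        (distrib a (monomial S x) (monomial S y) (monomial S z))
  where
  distrib : ∀ t p q r → ((t xor t) xor t) ∧ ((p xor q) xor r) ≡ ((t ∧ p) xor (t ∧ q)) xor (t ∧ r)
  distrib false _ _ _ = refl
  distrib true  _ _ _ = refl
monomial-affineAlong (true ∷ S)  (true ∷ H)  (s≤s o₀) (a ∷ x) (b ∷ y) (c ∷ z) x~y x~z = begin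
  ((a xor b) xor c) ∧ monomial S ((x ⊕ y) ⊕ z)
    ≡⟨ cong (((a xor b) xor c) ∧_) (constant ((x ⊕ y) ⊕ z) x xyz~x) ⟩
  ((a xor b) xor c) ∧ monomial S x
    ≡⟨ distrib a b c (monomial S x) ⟩
  ((a ∧ monomial S x) xor (b ∧ monomial S x)) xor (c ∧ monomial S x)
    ≡⟨ cong₂ (λ p q → ((a ∧ monomial S x) xor (b ∧ p)) xor (c ∧ q)) (constant x y x~y) (constant x z x~z) ⟩
  ((a ∧ monomial S x) xor (b ∧ monomial S y)) xor (c ∧ monomial S z) ∎
  where
  open ≡-Reasoning
  constant : ∀ u v → coordSub H (u ⊕ v) ≡ true → monomial S u ≡ monomial S v
  constant u v = monomial-constantAlong S H u v (ℕP.n≤0⇒n≡0 o₀)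
  xyz~x : coordSub H (((x ⊕ y) ⊕ z) ⊕ x) ≡ true
  xyz~x = subst (λ v → coordSub H v ≡ true)
                (trans (cong ((x ⊕ y) ⊕_) (⊕-comm x z)) (sym (⊕-assoc (x ⊕ y) z x)))
                (coordSub-⊕ H _ _ x~y x~z)
  distrib : ∀ a b c t → ((a xor b) xor c) ∧ t ≡ ((a ∧ t) xor (b ∧ t)) xor (c ∧ t)
  distrib a b c t = trans (∧-distribʳ-xor t (a xor b) c) (cong (_xor (c ∧ t)) (∧-distribʳ-xor t a b))

xorSum-affineAlong : ∀ {k n} {W : Subset n} (g : Vec Bool k → Vec Bool n → Bool)
  → (∀ S → AffineAlong W (g S)) → AffineAlong W (λ x → XorSum.⨁ (λ S → g S x))
xorSum-affineAlong {k} g affine x y z x~y x~z = begin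
  XorSum.⨁ (λ S → g S ((x ⊕ y) ⊕ z))
    ≡⟨ XorSum.⨁-cong (λ S → affine S x y z x~y x~z) ⟩
  XorSum.⨁ (λ S → (g S x xor g S y) xor g S z)
    ≡⟨ XorSum.⨁-∙ k (λ S → g S x xor g S y) (λ S → g S z) ⟩
  XorSum.⨁ (λ S → g S x xor g S y) xor XorSum.⨁ (λ S → g S z)
    ≡⟨ cong (_xor XorSum.⨁ (λ S → g S z)) (XorSum.⨁-∙ k (λ S → g S x) (λ S → g S y)) ⟩
  (XorSum.⨁ (λ S → g S x) xor XorSum.⨁ (λ S → g S y)) xor XorSum.⨁ (λ S → g S z) ∎
  where open ≡-Reasoning

polyP-affineAlong : ∀ {n} (α : Vec Bool n → Bool) (H : Vec Bool n)
  → (∀ S → 2 ≤ overlapSize S H → α S ≡ false) → AffineAlong (coordSub H) (polyP α)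
polyP-affineAlong α H sparse = xorSum-affineAlong {W = coordSub H} (λ S x → α S ∧ monomial S x) term
  where
  term : ∀ S → AffineAlong (coordSub H) (λ x → α S ∧ monomial S x)
  term S with α S in αS
  ... | false = λ _ _ _ _ _ → refl
  ... | true with 2 ℕ.≤? overlapSize S H
  ...   | yes o₂ = case trans (sym αS) (sparse S o₂) of λ ()
  ...   | no  o≱2 = monomial-affineAlong S H (ℕP.≤-pred (ℕP.≰⇒> o≱2))

coordSub-cons-same : ∀ {n} h (H : Vec Bool n) c (u w : Vec Bool n)
  → coordSub (h ∷ H) ((c ∷ u) ⊕ (c ∷ w)) ≡ coordSub H (u ⊕ w)
coordSub-cons-same h H c u w =
  cong (_∧ coordSub H (u ⊕ w)) (trans (cong (λ b → h ∨ not b) (xor-same c)) (∨-zeroʳ h))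

coordSub-self : ∀ {n} (H u : Vec Bool n) → coordSub H (u ⊕ u) ≡ true
coordSub-self H u = subst (λ v → coordSub H v ≡ true) (sym (⊕-self u)) (coordSub-zero H)

variesAlong-slice : ∀ {n} h (H : Vec Bool n) (α : Vec Bool (suc n) → Bool) c
  → VariesAlong (coordSub H) (polyP (slice α c)) → VariesAlong (coordSub (h ∷ H)) (polyP α)
variesAlong-slice h H α c (u , w , u~w , varies) =
  c ∷ u , c ∷ w , trans (coordSub-cons-same h H c u w) u~w ,
  trans (cong₂ _xor_ (polyP-slice α c u) (polyP-slice α c w)) varies

nonAffineAlong-slice : ∀ {n} h (H : Vec Bool n) (α : Vec Bool (suc n) → Bool) c
  → NonAffineAlong (coordSub H) (polyP (slice α c)) → NonAffineAlong (coordSub (h ∷ H)) (polyP α)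
nonAffineAlong-slice h H α c (x , y , z , x~y , x~z , defect) =
  c ∷ x , c ∷ y , c ∷ z ,
  trans (coordSub-cons-same h H c x y) x~y , trans (coordSub-cons-same h H c x z) x~z ,
  trans (cong₂ _xor_ (trans (cong (λ d → polyP α (d ∷ ((x ⊕ y) ⊕ z))) (xor-triple c)) (polyP-slice α c _))
                     (cong₂ _xor_ (cong₂ _xor_ (polyP-slice α c x) (polyP-slice α c y)) (polyP-slice α c z)))
        defect
  where
  xor-triple : ∀ c → (c xor c) xor c ≡ c
  xor-triple false = refl
  xor-triple true  = refl

derivative-nonzero⇒variesAlong : ∀ {n} (H : Vec Bool n) (α : Vec Bool (suc n) → Bool)
  → (∃ λ v → polyP (λ S → α (true ∷ S)) v ≡ true) → VariesAlong (coordSub (true ∷ H)) (polyP α)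
derivative-nonzero⇒variesAlong H α (v , P₁v) =
  false ∷ v , true ∷ v , coordSub-self H v , trans (polyP-derivative α v) P₁v

derivative-variesAlong⇒nonAffineAlong : ∀ {n} (H : Vec Bool n) (α : Vec Bool (suc n) → Bool)
  → VariesAlong (coordSub H) (polyP (λ S → α (true ∷ S))) → NonAffineAlong (coordSub (true ∷ H)) (polyP α)
derivative-variesAlong⇒nonAffineAlong H α (u , w , u~w , varies) =
  false ∷ u , true ∷ u , true ∷ w , coordSub-self H u , u~w , defect
  where
  P = polyP α
  defect : P (false ∷ ((u ⊕ u) ⊕ w)) xor ((P (false ∷ u) xor P (true ∷ u)) xor P (true ∷ w)) ≡ true
  defect = begin
    P (false ∷ ((u ⊕ u) ⊕ w)) xor ((P (false ∷ u) xor P (true ∷ u)) xor P (true ∷ w))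
      ≡⟨ cong (λ v → P (false ∷ v) xor ((P (false ∷ u) xor P (true ∷ u)) xor P (true ∷ w)))
              (trans (cong (_⊕ w) (⊕-self u)) (⊕-identityˡ w)) ⟩
    P (false ∷ w) xor ((P (false ∷ u) xor P (true ∷ u)) xor P (true ∷ w))
      ≡⟨ xor-swapˡ (P (false ∷ w)) (P (false ∷ u) xor P (true ∷ u)) (P (true ∷ w)) ⟩
    (P (false ∷ u) xor P (true ∷ u)) xor (P (false ∷ w) xor P (true ∷ w))
      ≡⟨ cong₂ _xor_ (polyP-derivative α u) (polyP-derivative α w) ⟩
    polyP (λ S → α (true ∷ S)) u xor polyP (λ S → α (true ∷ S)) w
      ≡⟨ varies ⟩
    true ∎
    where open ≡-Reasoning

polyP-variesAlong : ∀ {n} (α : Vec Bool n → Bool) (H S : Vec Bool n) → α S ≡ true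
  → 1 ≤ overlapSize S H → VariesAlong (coordSub H) (polyP α)
polyP-variesAlong α []      []      _  ()
polyP-variesAlong α (h ∷ H) (b ∷ S) αS o₁ with overlapSize S H in oS
... | suc _ with slice-coefficient α b S αS
...   | c , sliceS =
  variesAlong-slice h H α c (polyP-variesAlong (slice α c) H S sliceS (subst (1 ≤_) (sym oS) (s≤s z≤n)))
polyP-variesAlong α (true ∷ H) (true ∷ S) αS o₁ | zero =
  derivative-nonzero⇒variesAlong H α (polyP-nonzero (λ S → α (true ∷ S)) S αS)

polyP-nonAffineAlong : ∀ {n} (α : Vec Bool n → Bool) (H S : Vec Bool n) → α S ≡ true
  → 2 ≤ overlapSize S H → NonAffineAlong (coordSub H) (polyP α)
polyP-nonAffineAlong α []      []      _  ()
polyP-nonAffineAlong α (h ∷ H) (b ∷ S) αS o₂ with overlapSize S H in oS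
... | suc (suc _) with slice-coefficient α b S αS
...   | c , sliceS =
  nonAffineAlong-slice h H α c (polyP-nonAffineAlong (slice α c) H S sliceS (subst (2 ≤_) (sym oS) (s≤s (s≤s z≤n))))
polyP-nonAffineAlong α (true ∷ H) (true ∷ S) αS o₂ | suc zero =
  derivative-variesAlong⇒nonAffineAlong H α
    (polyP-variesAlong (λ S → α (true ∷ S)) H S αS (subst (1 ≤_) (sym oS) (s≤s z≤n)))
polyP-nonAffineAlong α (true  ∷ H) (false ∷ S) αS (s≤s ()) | suc zero
polyP-nonAffineAlong α (false ∷ H) (true  ∷ S) αS (s≤s ()) | suc zero
polyP-nonAffineAlong α (false ∷ H) (false ∷ S) αS (s≤s ()) | suc zero
polyP-nonAffineAlong α (true  ∷ H) (true  ∷ S) αS (s≤s ()) | zero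

-- The C-condition for π

headFree : ∀ {n} → Subset n → Subset (suc n)
headFree W (_ ∷ x) = W x

headZero : ∀ {n} → Subset n → Subset (suc n)
headZero W (b ∷ x) = not b ∧ W x

CCondition-cong : ∀ {m} {π : Vec Bool m → Vec Bool m} {L L′ : Subset m}
  → (∀ v → L v ≡ L′ v) → CCondition π L → CCondition π L′
CCondition-cong {π = π} L≗L′ cc a = isFlat-cong (λ x → L≗L′ (π x ⊕ a)) (cc a)

piP-involutive : ∀ {n} (α : Vec Bool n → Bool) (x : Vec Bool (suc n)) → piP α (piP α x) ≡ x
piP-involutive α (x₀ ∷ x) = cong (_∷ x) (xor-cancelʳ x₀ (polyP α x))

CCondition-headFree : ∀ {n} {W : Subset n} (α : Vec Bool n → Bool) → IsSubspace W
  → CCondition (piP α) (headFree W)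
CCondition-headFree {W = W} α (W-zero , W-⊕) (a₀ ∷ a) =
  isFlat-cong (λ { (x₀ ∷ x) → refl })
    ((a₀ ∷ a) , headFree W , (W-zero , λ { (_ ∷ x) (_ ∷ y) → W-⊕ x y }) , λ _ → refl)

affineAlong⇒CCondition-headZero : ∀ {n} {W : Subset n} (α : Vec Bool n → Bool) → IsSubspace W
  → AffineAlong W (polyP α) → CCondition (piP α) (headZero W)
affineAlong⇒CCondition-headZero {W = W} α (W-zero , W-⊕) affine (a₀ ∷ a) =
  affinelyClosed⇒isFlat ((a₀ xor P a) ∷ a) base closed
  where
  P = polyP α
  base : not (((a₀ xor P a) xor P a) xor a₀) ∧ W (a ⊕ a) ≡ true
  base = cong₂ _∧_ (cong not (trans (cong (_xor a₀) (xor-cancelʳ a₀ (P a))) (xor-same a₀)))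
                   (subst (λ v → W v ≡ true) (sym (⊕-self a)) W-zero)
  closed : AffinelyClosed (preimage (piP α) (coset (a₀ ∷ a) (headZero W)))
  closed (x₀ ∷ x) (y₀ ∷ y) (z₀ ∷ z) Sx Sy Sz = cong₂ _∧_ head tail
    where
    onGraph : ∀ t v → not ((t xor P v) xor a₀) ∧ W (v ⊕ a) ≡ true → (t xor P v) xor a₀ ≡ false
    onGraph t v S = trans (sym (not-involutive _)) (cong not (∧-true₁ S))
    x~y : W (x ⊕ y) ≡ true
    x~y = subst (λ v → W v ≡ true) (⊕-shift x y a) (W-⊕ _ _ (∧-true₂ Sx) (∧-true₂ Sy))
    x~z : W (x ⊕ z) ≡ true
    x~z = subst (λ v → W v ≡ true) (⊕-shift x z a) (W-⊕ _ _ (∧-true₂ Sx) (∧-true₂ Sz))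
    tail : W (((x ⊕ y) ⊕ z) ⊕ a) ≡ true
    tail = subst (λ v → W v ≡ true) (⊕-shift₃ x y z a)
                 (W-⊕ _ _ (W-⊕ _ _ (∧-true₂ Sx) (∧-true₂ Sy)) (∧-true₂ Sz))
    head : not ((((x₀ xor y₀) xor z₀) xor P ((x ⊕ y) ⊕ z)) xor a₀) ≡ true
    head = cong not (begin
      (((x₀ xor y₀) xor z₀) xor P ((x ⊕ y) ⊕ z)) xor a₀
        ≡⟨ cong (λ p → (((x₀ xor y₀) xor z₀) xor p) xor a₀) (affine x y z x~y x~z) ⟩
      (((x₀ xor y₀) xor z₀) xor ((P x xor P y) xor P z)) xor a₀
        ≡⟨ cong (_xor a₀) (xor-interchange (x₀ xor y₀) z₀ (P x xor P y) (P z)) ⟩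
      (((x₀ xor y₀) xor (P x xor P y)) xor (z₀ xor P z)) xor a₀
        ≡⟨ cong (λ t → (t xor (z₀ xor P z)) xor a₀) (xor-interchange x₀ y₀ (P x) (P y)) ⟩
      (((x₀ xor P x) xor (y₀ xor P y)) xor (z₀ xor P z)) xor a₀
        ≡⟨ sym (xor-shift₃ (x₀ xor P x) (y₀ xor P y) (z₀ xor P z) a₀) ⟩
      (((x₀ xor P x) xor a₀) xor ((y₀ xor P y) xor a₀)) xor ((z₀ xor P z) xor a₀)
        ≡⟨ cong₂ _xor_ (cong₂ _xor_ (onGraph x₀ x Sx) (onGraph y₀ y Sy)) (onGraph z₀ z Sz) ⟩
      false ∎)
      where open ≡-Reasoning

CCondition-headZero⇒affineAlong : ∀ {n} {W : Subset n} (α : Vec Bool n → Bool) → IsSubspace W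
  → CCondition (piP α) (headZero W) → AffineAlong W (polyP α)
CCondition-headZero⇒affineAlong {W = W} α (W-zero , _) cc x y z x~y x~z =
  agree (isFlat⇒affinelyClosed (cc (false ∷ x)) (P x ∷ x) (P y ∷ y) (P z ∷ z)
           (onGraph x (subst (λ v → W v ≡ true) (sym (⊕-self x)) W-zero))
           (onGraph y (subst (λ v → W v ≡ true) (⊕-comm x y) x~y))
           (onGraph z (subst (λ v → W v ≡ true) (⊕-comm x z) x~z)))
  where
  P = polyP α
  onGraph : ∀ v → W (v ⊕ x) ≡ true → not ((P v xor P v) xor false) ∧ W (v ⊕ x) ≡ true
  onGraph v v~x = cong₂ _∧_ (cong (λ b → not (b xor false)) (xor-same (P v))) v~x
  agree : ∀ {q p} {w} → not ((q xor p) xor false) ∧ w ≡ true → p ≡ q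
  agree {false} {false} _ = refl
  agree {true}  {true}  _ = refl

theorem4p1 : (n : ℕ) → 2 ≤ suc n → (s : ℕ) → 1 ≤ s → s ≤ suc n
    → (α : Vec Bool n → Bool)
    → ((CCondition (piP α) (LA s) × IsBent (fC (piP α) (LA s)))
      × (((S : Vec Bool n) → 2 ≤ highCount s S → α S ≡ false)
        → CCondition (piP α) (LB s) × IsBent (fC (piP α) (LB s)))
      × ((∃ λ (S : Vec Bool n) → (2 ≤ highCount s S) × (α S ≡ true))
        → ¬ CCondition (piP α) (LB s)))
theorem4p1 n _ (suc s) _ _ α =
    (ccA , bent (maskA (suc n) (suc s)) (LA≗coordSub (suc s)) ccA)
  , (λ sparse → ccB sparse , bent (maskB (suc n) (suc s)) (LB≗coordSub (suc s)) (ccB sparse))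
  , ¬ccB
  where
  bent = CCondition⇒isBent (piP α) (piP α) (piP-involutive α) (piP-involutive α)
  H = maskB n s
  LB≗headZero : ∀ v → LB (suc s) v ≡ headZero (coordSub H) v
  LB≗headZero (b ∷ v) = cong (not b ∧_) (LB≗coordSub s v)
  ccA : CCondition (piP α) (LA (suc s))
  ccA = CCondition-cong {π = piP α} {L = headFree (coordSub (maskA n s))} {L′ = LA (suc s)}
                        (λ { (_ ∷ v) → sym (LA≗coordSub s v) })
                        (CCondition-headFree α (coordSub-isSubspace (maskA n s)))
  ccB : (∀ S → 2 ≤ highCount (suc s) S → α S ≡ false) → CCondition (piP α) (LB (suc s))
  ccB sparse = CCondition-cong {π = piP α} (sym ∘ LB≗headZero)
    (affineAlong⇒CCondition-headZero α (coordSub-isSubspace H)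
      (polyP-affineAlong α H (λ S o₂ → sparse S (subst (2 ≤_) (sym (highCount≡overlapSize s S)) o₂))))
  ¬ccB : (∃ λ S → (2 ≤ highCount (suc s) S) × (α S ≡ true)) → ¬ CCondition (piP α) (LB (suc s))
  ¬ccB (S , o₂ , αS) cc = nonAffineAlong⇒¬affineAlong {W = coordSub H} {f = polyP α}
    (polyP-nonAffineAlong α H S αS (subst (2 ≤_) (highCount≡overlapSize s S) o₂))
    (CCondition-headZero⇒affineAlong α (coordSub-isSubspace H) (CCondition-cong {π = piP α} LB≗headZero cc))
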